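{- Let $G$ be a finite group, $H$ a subgroup of $G$, $X$ a normal subset of $G$ and $b$ an involution of $G$ such that $b^{ -1}Hb=H$. Then $H\in\mathcal{P}(G,X)$ if and only if $Hb\in\mathcal{P}(G,X)$.
   Context: A subset $X$ of $G$ is normal if $g^{ -1}Xg=X$ for all $g\in G$. The Cayley sum graph $\mathrm{CS}(G,X)$ has vertex set $G$, with distinct vertices $g,h$ adjacent iff $gh\in X$. $\mathcal{P}(G,X)$ denotes the set of subsets of $G$ that are perfect codes in $\mathrm{CS}(G,X)$, where a perfect code is an independent set $C$ such that every vertex outside $C$ has exactly one neighbour in $C$. -}

module Defs where

open import Level using (Level; _⊔_)
open import Algebra.Bundles using (Group)
open import Data.Nat using (ℕ)
open import Data.Fin using (Fin)
open import Data.Product using (Σ; ∃; _×_; _,_)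
open import Relation.Nullary using (¬_)
open import Relation.Unary using (Pred; _≐_)
open import Relation.Binary.Definitions using (_Respects_)

module GroupDefs {c ℓ : Level} (G : Group c ℓ) where
  open Group G

  Finite : Set (c ⊔ ℓ)
  Finite = ∃ λ (n : ℕ) → Σ (Fin n → Carrier) λ f → ∀ g → ∃ λ i → f i ≈ g

  record IsSubgroup {p : Level} (H : Pred Carrier p) : Set (c ⊔ ℓ ⊔ p) where
    field
      resp  : H Respects _≈_
      ε∈    : H ε
      ∙-closed : ∀ {x y} → H x → H y → H (x ∙ y)
      ⁻¹-closed : ∀ {x} → H x → H (x ⁻¹)

  Conj : {p : Level} → Carrier → Pred Carrier p → Pred Carrier (c ⊔ ℓ ⊔ p)
  Conj g X y = ∃ λ x → X x × (y ≈ (g ⁻¹ ∙ x) ∙ g)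

  RightMul : {p : Level} → Pred Carrier p → Carrier → Pred Carrier (c ⊔ ℓ ⊔ p)
  RightMul X b y = ∃ λ x → X x × (y ≈ x ∙ b)

  record IsNormalSubset {p : Level} (X : Pred Carrier p) : Set (c ⊔ ℓ ⊔ p) where
    field
      resp : X Respects _≈_
      conj : ∀ g → Conj g X ≐ X

  IsInvolution : Carrier → Set ℓ
  IsInvolution b = (b ∙ b ≈ ε) × ¬ (b ≈ ε)

  -- adjacency in the Cayley sum graph CS(G,X): distinct g,h with g h ∈ X
  Adj : {p : Level} → Pred Carrier p → Carrier → Carrier → Set (ℓ ⊔ p)
  Adj X g h = ¬ (g ≈ h) × X (g ∙ h)

  record IsPerfectCode {p q : Level} (X : Pred Carrier p) (C : Pred Carrier q)
      : Set (c ⊔ ℓ ⊔ p ⊔ q) where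
    field
      independent : ∀ {g h} → C g → C h → ¬ Adj X g h
      exists-nbr  : ∀ g → ¬ C g → ∃ λ h → C h × Adj X g h
      unique-nbr  : ∀ g → ¬ C g → ∀ {h h′} → C h → Adj X g h → C h′ → Adj X g h′ → h ≈ h′

-- Put Hb = RightMul H b. Since b normalises H, Hb = bH, and g ↦ b g, k ↦ k b identify the
-- neighbours of g in Hb with the neighbours of b g in H (and conversely): a normal X is
-- invariant under conjugation by b. So domination transfers verbatim, and only independence
-- needs an argument. Writing the elements of H and Hb as x and x b, both independence
-- conditions read "x σ(y) ∈ X forces x = y" (σ = id, resp. σ(y) = b y b), which holds iff
-- H ∩ X ⊆ {ε} and, when ε ∈ X, σ inverts H. If b ∈ H then Hb = H. Otherwise b (resp. ε) lies
-- outside the code and its unique neighbour h₀ is fixed by a twisted conjugation by every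
-- element of H; this turns "every element of H is an involution" into "b inverts H" and back.

module Submission where

open import Level using (Level)
open import Algebra.Bundles using (Group)
open import Data.Product using (∃; _×_; _,_; proj₁; map₂)
open import Effect.Monad using (RawMonad)
open import Function.Base using (id; _∘_)
open import Function.Bundles using (_⇔_; mk⇔; Equivalence)
open import Relation.Binary.Definitions using (_Respects_)
open import Relation.Nullary using (¬_; yes; no)
open import Relation.Nullary.Decidable using (¬¬-excluded-middle)
open import Relation.Nullary.Negation using (¬¬-Monad)
open import Relation.Unary using (Pred; _≐_; _⊆_)
open import Defs

module PerfectCodes {c ℓ : Level} (G : Group c ℓ) where

  open Group G
  open GroupDefs G
  open import Algebra.Properties.Group G
    using (∙-cancelʳ; identityˡ-unique; inverseˡ-unique; ⁻¹-involutive; ⁻¹-anti-homo-∙; x∙y⁻¹≈ε⇒x≈y)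
  open import Algebra.Properties.Monoid monoid using (cancelˡ; cancelʳ; insertʳ)
  open import Algebra.Properties.Semigroup semigroup using ([uv∙w]x≈u[vw∙x]; uv∙wx≈u[vw∙x])
  open import Relation.Binary.Reasoning.Setoid setoid
  open RawMonad (¬¬-Monad {ℓ}) using (_>>=_; pure)

  private
    variable
      p p′ q : Level
      b g h x y w : Carrier

  self-inverses-commute : x ≈ x ⁻¹ → y ≈ y ⁻¹ → x ∙ y ≈ (x ∙ y) ⁻¹ → x ∙ y ≈ y ∙ x
  self-inverses-commute {x} {y} x≈x⁻¹ y≈y⁻¹ xy≈[xy]⁻¹ = begin
    x ∙ y         ≈⟨ xy≈[xy]⁻¹ ⟩
    (x ∙ y) ⁻¹    ≈⟨ ⁻¹-anti-homo-∙ x y ⟩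
    y ⁻¹ ∙ x ⁻¹   ≈⟨ ∙-cong y≈y⁻¹ x≈x⁻¹ ⟨
    y ∙ x         ∎

  commuting-fixed⇒≈ : x ∙ y ≈ y ∙ x → y ≈ (w ∙ y) ∙ x ⁻¹ → w ≈ x
  commuting-fixed⇒≈ {x} {y} {w} xy≈yx y≈wyx⁻¹ = ∙-cancelʳ y w x (begin
    w ∙ y                ≈⟨ insertʳ (inverseˡ x) (w ∙ y) ⟩
    ((w ∙ y) ∙ x ⁻¹) ∙ x  ≈⟨ ∙-congʳ y≈wyx⁻¹ ⟨
    y ∙ x                ≈⟨ xy≈yx ⟨
    x ∙ y                ∎)

  fixed-by-twisted-conjugation⇒self-inverse :
    h ≈ (h ∙ h) ∙ h → h ≈ ((x ∙ h) ∙ h) ∙ (x ∙ h) → x ≈ x ⁻¹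
  fixed-by-twisted-conjugation⇒self-inverse {h} {x} h≈hhh h≈xhhxh =
    inverseˡ-unique x x (identityˡ-unique (x ∙ x) h (begin
      (x ∙ x) ∙ h              ≈⟨ assoc x x h ⟩
      x ∙ (x ∙ h)              ≈⟨ ∙-congʳ (cancelʳ hh≈ε x) ⟨
      ((x ∙ h) ∙ h) ∙ (x ∙ h)  ≈⟨ h≈xhhxh ⟨
      h                        ∎))
    where
    hh≈ε : h ∙ h ≈ ε
    hh≈ε = identityˡ-unique (h ∙ h) h (sym h≈hhh)

  module _ {X : Pred Carrier q} (normal : IsNormalSubset X) where
    open IsNormalSubset normal

    conjugate-closed : X y → X ((g ∙ y) ∙ g ⁻¹)
    conjugate-closed {y} {g} Xy =
      proj₁ (conj (g ⁻¹)) (y , Xy , ∙-congʳ (∙-congʳ (sym (⁻¹-involutive g))))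

  Independent : Pred Carrier q → Pred Carrier p → Set _
  Independent X C = ∀ {g h} → C g → C h → ¬ Adj X g h

  outside-apart : {C : Pred Carrier p} → C Respects _≈_ → ¬ C g → C h → ¬ g ≈ h
  outside-apart C-resp ¬Cg Ch g≈h = ¬Cg (C-resp (sym g≈h) Ch)

  neighbour-unique : {X : Pred Carrier q} {C : Pred Carrier p} → C Respects _≈_ →
    IsPerfectCode X C → ¬ C g → C h → X (g ∙ h) → C w → X (g ∙ w) → h ≈ w
  neighbour-unique C-resp code ¬Cg Ch Xgh Cw Xgw =
    IsPerfectCode.unique-nbr code _ ¬Cg
      Ch (outside-apart C-resp ¬Cg Ch , Xgh) Cw (outside-apart C-resp ¬Cg Cw , Xgw)

  module _ (b∙b≈ε : b ∙ b ≈ ε)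
           {X : Pred Carrier q} (X-resp : X Respects _≈_) (X-b : ∀ {y} → X y → X ((b ∙ y) ∙ b))
           {C : Pred Carrier p} {D : Pred Carrier p′}
           (C-resp : C Respects _≈_) (D-resp : D Respects _≈_)
           (C-left⇒D : ∀ {g} → C (b ∙ g) → D g)
           (C⇒D-right : ∀ {h} → C h → D (h ∙ b))
           (D⇒C-right : ∀ {k} → D k → C (k ∙ b)) where

    perfect-code-transfer : IsPerfectCode X C → Independent X D → IsPerfectCode X D
    perfect-code-transfer code D-independent = record
      { independent = D-independent
      ; exists-nbr  = exists
      ; unique-nbr  = λ g ¬Dg Dk (_ , Xgk) Dk′ (_ , Xgk′) →
          ∙-cancelʳ b _ _ (neighbour-unique C-resp code (¬Dg ∘ C-left⇒D)
            (D⇒C-right Dk) (X-resp ([b∙gk]b≈bg∙kb g _) (X-b Xgk))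
            (D⇒C-right Dk′) (X-resp ([b∙gk]b≈bg∙kb g _) (X-b Xgk′)))
      }
      where
      open IsPerfectCode code using (exists-nbr)

      [b∙gk]b≈bg∙kb : ∀ g k → (b ∙ (g ∙ k)) ∙ b ≈ (b ∙ g) ∙ (k ∙ b)
      [b∙gk]b≈bg∙kb g k = trans (∙-congʳ (sym (assoc b g k))) (assoc (b ∙ g) k b)

      [b∙[bg]h]b≈g∙hb : ∀ g h → (b ∙ ((b ∙ g) ∙ h)) ∙ b ≈ g ∙ (h ∙ b)
      [b∙[bg]h]b≈g∙hb g h = begin
        (b ∙ ((b ∙ g) ∙ h)) ∙ b  ≈⟨ ∙-congʳ (∙-congˡ (assoc b g h)) ⟩
        (b ∙ (b ∙ (g ∙ h))) ∙ b  ≈⟨ ∙-congʳ (cancelˡ b∙b≈ε (g ∙ h)) ⟩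
        (g ∙ h) ∙ b              ≈⟨ assoc g h b ⟩
        g ∙ (h ∙ b)              ∎

      exists : ∀ g → ¬ D g → ∃ λ k → D k × Adj X g k
      exists g ¬Dg with exists-nbr (b ∙ g) (¬Dg ∘ C-left⇒D)
      ... | h , Ch , _ , X[bg]h =
        h ∙ b , C⇒D-right Ch , outside-apart D-resp ¬Dg (C⇒D-right Ch)
              , X-resp ([b∙[bg]h]b≈g∙hb g h) (X-b X[bg]h)

  -- Setoid equality is not decidable, so independence only yields equalities up to ¬ ¬.
  TwistedIndependent : (Carrier → Carrier) → Pred Carrier q → Pred Carrier p → Set _
  TwistedIndependent σ X H = ∀ {x y} → H x → H y → X (x ∙ σ y) → ¬ ¬ (x ≈ y)

  Inverts : (Carrier → Carrier) → Pred Carrier p → Set _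
  Inverts σ H = ∀ {u} → H u → ¬ ¬ (σ u ≈ u ⁻¹)

  independent⇔twisted-id : {X : Pred Carrier q} {H : Pred Carrier p} →
    Independent X H ⇔ TwistedIndependent id X H
  independent⇔twisted-id = mk⇔
    (λ independent {_} {_} Hx Hy Xxy x≉y → independent Hx Hy (x≉y , Xxy))
    (λ twisted {_} {_} Hx Hy (x≉y , Xxy) → twisted Hx Hy Xxy x≉y)

  RightMul-independent⇔twisted : {X : Pred Carrier q} {H : Pred Carrier p} → X Respects _≈_ →
    Independent X (RightMul H b) ⇔ TwistedIndependent (λ y → (b ∙ y) ∙ b) X H
  RightMul-independent⇔twisted {b = b} X-resp = mk⇔
    (λ independent {x} {y} Hx Hy X[x∙byb] x≉y →
      independent (x , Hx , refl) (y , Hy , refl)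
        ( (λ xb≈yb → x≉y (∙-cancelʳ b x y xb≈yb))
        , X-resp (sym (uv∙wx≈u[vw∙x] x b y b)) X[x∙byb] ))
    (λ twisted {_} {_} (x , Hx , g≈xb) (y , Hy , h≈yb) (g≉h , Xgh) →
      twisted Hx Hy (X-resp (trans (∙-cong g≈xb h≈yb) (uv∙wx≈u[vw∙x] x b y b)) Xgh)
        (λ x≈y → g≉h (trans g≈xb (trans (∙-congʳ x≈y) (sym h≈yb)))))

  module _ {H : Pred Carrier p} (subgroup : IsSubgroup H)
           {σ : Carrier → Carrier} (σ-closed : ∀ {u} → H u → H (σ u)) (σ-ε : σ ε ≈ ε)
           {X : Pred Carrier q} (X-resp : X Respects _≈_) where
    open IsSubgroup subgroup

    twisted-independent⇔ : TwistedIndependent σ X H ⇔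
      ((∀ {z} → H z → X z → ¬ ¬ (z ≈ ε)) × (X ε → Inverts σ H))
    twisted-independent⇔ = mk⇔ conditions independence
      where
      conditions : TwistedIndependent σ X H →
        (∀ {z} → H z → X z → ¬ ¬ (z ≈ ε)) × (X ε → Inverts σ H)
      conditions twisted =
        (λ {z} Hz Xz → twisted Hz ε∈ (X-resp (sym (trans (∙-congˡ σ-ε) (identityʳ z))) Xz))
        , λ Xε {u} Hu → do
          [σu]⁻¹≈u ← twisted (⁻¹-closed (σ-closed Hu)) Hu (X-resp (sym (inverseˡ (σ u))) Xε)
          pure (trans (sym (⁻¹-involutive (σ u))) (⁻¹-cong [σu]⁻¹≈u))

      independence : (∀ {z} → H z → X z → ¬ ¬ (z ≈ ε)) × (X ε → Inverts σ H) →
        TwistedIndependent σ X H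
      independence (meets-only-at-ε , inverts) {x} {y} Hx Hy Xxσy = do
        xσy≈ε ← meets-only-at-ε (∙-closed Hx (σ-closed Hy)) Xxσy
        σy≈y⁻¹ ← inverts (X-resp xσy≈ε Xxσy) Hy
        pure (x∙y⁻¹≈ε⇒x≈y x y (trans (∙-congˡ (sym σy≈y⁻¹)) xσy≈ε))

  module _ {H : Pred Carrier p} (subgroup : IsSubgroup H)
           {X : Pred Carrier q} (X-resp : X Respects _≈_)
           {σ τ : Carrier → Carrier}
           (σ-closed : ∀ {u} → H u → H (σ u)) (σ-ε : σ ε ≈ ε)
           (τ-closed : ∀ {u} → H u → H (τ u)) (τ-ε : τ ε ≈ ε) where

    twisted-independent-transfer : (Inverts σ H → Inverts τ H) →
      TwistedIndependent σ X H → TwistedIndependent τ X H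
    twisted-independent-transfer transfer twisted =
      Equivalence.from (twisted-independent⇔ subgroup τ-closed τ-ε X-resp)
        (map₂ (transfer ∘_)
          (Equivalence.to (twisted-independent⇔ subgroup σ-closed σ-ε X-resp) twisted))

  RightMul-resp : {H : Pred Carrier p} → RightMul H b Respects _≈_
  RightMul-resp g≈h (x , Hx , g≈xb) = x , Hx , trans (sym g≈h) g≈xb

  module Coset {H : Pred Carrier p} (subgroup : IsSubgroup H)
               {b : Carrier} (b∙b≈ε : b ∙ b ≈ ε) (normalises : Conj b H ≐ H) where
    open IsSubgroup subgroup renaming (resp to H-resp)

    b≈b⁻¹ : b ≈ b ⁻¹
    b≈b⁻¹ = inverseˡ-unique b b b∙b≈ε

    conj-closed : H y → H ((b ∙ y) ∙ b)
    conj-closed {y} Hy = proj₁ normalises (y , Hy , ∙-congʳ (∙-congʳ b≈b⁻¹))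

    conj-ε : (b ∙ ε) ∙ b ≈ ε
    conj-ε = trans (∙-congʳ (identityʳ b)) b∙b≈ε

    RightMul⇒∙b : RightMul H b g → H (g ∙ b)
    RightMul⇒∙b (x , Hx , g≈xb) = H-resp (sym (trans (∙-congʳ g≈xb) (cancelʳ b∙b≈ε x))) Hx

    ∙b∈RightMul : H h → RightMul H b (h ∙ b)
    ∙b∈RightMul Hh = _ , Hh , refl

    ∙b⇒RightMul : H (g ∙ b) → RightMul H b g
    ∙b⇒RightMul {g} Hgb = g ∙ b , Hgb , sym (cancelʳ b∙b≈ε g)

    b∙⇒RightMul : H (b ∙ g) → RightMul H b g
    b∙⇒RightMul {g} Hbg = ∙b⇒RightMul (H-resp (∙-congʳ (cancelˡ b∙b≈ε g)) (conj-closed Hbg))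

    RightMul-b∙⇒ : RightMul H b (b ∙ g) → H g
    RightMul-b∙⇒ {g} Hb[bg] = H-resp bbgbb≈g (conj-closed (RightMul⇒∙b Hb[bg]))
      where
      bbgbb≈g : (b ∙ ((b ∙ g) ∙ b)) ∙ b ≈ g
      bbgbb≈g = trans (∙-congʳ (sym (assoc b (b ∙ g) b)))
                      (trans (cancelʳ b∙b≈ε _) (cancelˡ b∙b≈ε g))

    ε∉RightMul : ¬ H b → ¬ RightMul H b ε
    ε∉RightMul ¬Hb = ¬Hb ∘ H-resp (identityˡ b) ∘ RightMul⇒∙b

    ∈⇒RightMul⊆ : H b → RightMul H b ⊆ H
    ∈⇒RightMul⊆ Hb (x , Hx , g≈xb) = H-resp (sym g≈xb) (∙-closed Hx Hb)

    ∈⇒⊆RightMul : H b → H ⊆ RightMul H b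
    ∈⇒⊆RightMul Hb Hg = ∙b⇒RightMul (∙-closed Hg Hb)

    module _ {X : Pred Carrier q} (normal : IsNormalSubset X) where
      open IsNormalSubset normal renaming (resp to X-resp)

      X-conj : X y → X ((b ∙ y) ∙ b)
      X-conj Xy = X-resp (∙-congˡ (sym b≈b⁻¹)) (conjugate-closed normal Xy)

      perfect⇒inverts-conj : ¬ H b → IsPerfectCode X H →
        Inverts id H → Inverts (λ u → (b ∙ u) ∙ b) H
      perfect⇒inverts-conj ¬Hb code self-inverse {u} Hu with IsPerfectCode.exists-nbr code b ¬Hb
      ... | h₀ , Hh₀ , _ , Xbh₀ = do
        u≈u⁻¹ ← self-inverse Hu
        h₀≈h₀⁻¹ ← self-inverse Hh₀
        uh₀≈[uh₀]⁻¹ ← self-inverse (∙-closed Hu Hh₀)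
        pure (trans (commuting-fixed⇒≈ (self-inverses-commute u≈u⁻¹ h₀≈h₀⁻¹ uh₀≈[uh₀]⁻¹) h₀-fixed)
                    u≈u⁻¹)
        where
        ub≈b[bub] : u ∙ b ≈ b ∙ ((b ∙ u) ∙ b)
        ub≈b[bub] = trans (∙-congʳ (sym (cancelˡ b∙b≈ε u))) (assoc b (b ∙ u) b)

        conjugate≈ : (u ∙ (b ∙ h₀)) ∙ u ⁻¹ ≈ b ∙ ((((b ∙ u) ∙ b) ∙ h₀) ∙ u ⁻¹)
        conjugate≈ = begin
          (u ∙ (b ∙ h₀)) ∙ u ⁻¹              ≈⟨ ∙-congʳ (assoc u b h₀) ⟨
          ((u ∙ b) ∙ h₀) ∙ u ⁻¹              ≈⟨ ∙-congʳ (∙-congʳ ub≈b[bub]) ⟩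
          ((b ∙ ((b ∙ u) ∙ b)) ∙ h₀) ∙ u ⁻¹  ≈⟨ [uv∙w]x≈u[vw∙x] b _ h₀ (u ⁻¹) ⟩
          b ∙ ((((b ∙ u) ∙ b) ∙ h₀) ∙ u ⁻¹)  ∎

        h₀-fixed : h₀ ≈ (((b ∙ u) ∙ b) ∙ h₀) ∙ u ⁻¹
        h₀-fixed = neighbour-unique H-resp code ¬Hb Hh₀ Xbh₀
          (∙-closed (∙-closed (conj-closed Hu) Hh₀) (⁻¹-closed Hu))
          (X-resp conjugate≈ (conjugate-closed normal Xbh₀))

      perfect-RightMul⇒self-inverse : ¬ H b → IsPerfectCode X (RightMul H b) →
        Inverts (λ u → (b ∙ u) ∙ b) H → Inverts id H
      perfect-RightMul⇒self-inverse ¬Hb code inverts {x} Hx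
        with IsPerfectCode.exists-nbr code ε (ε∉RightMul ¬Hb)
      ... | k₀ , (h₀ , Hh₀ , k₀≈h₀b) , _ , Xεk₀ = do
        h₀-fixed-by-h₀ ← h₀≈vh₀v Hh₀
        h₀-fixed-by-xh₀ ← h₀≈vh₀v (∙-closed Hx Hh₀)
        pure (fixed-by-twisted-conjugation⇒self-inverse h₀-fixed-by-h₀ h₀-fixed-by-xh₀)
        where
        Xh₀b : X (h₀ ∙ b)
        Xh₀b = X-resp (trans (∙-congˡ k₀≈h₀b) (identityˡ _)) Xεk₀

        h₀≈vh₀∙bv⁻¹b : ∀ {v} → H v → h₀ ≈ (v ∙ h₀) ∙ ((b ∙ v ⁻¹) ∙ b)
        h₀≈vh₀∙bv⁻¹b {v} Hv = ∙-cancelʳ b _ _ (neighbour-unique RightMul-resp code (ε∉RightMul ¬Hb)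
          (h₀ , Hh₀ , refl) (X-resp (sym (identityˡ _)) Xh₀b)
          (_ , ∙-closed (∙-closed Hv Hh₀) (conj-closed (⁻¹-closed Hv)) , refl)
          (X-resp conjugate≈ (conjugate-closed normal Xh₀b)))
          where
          conjugate≈ : (v ∙ (h₀ ∙ b)) ∙ v ⁻¹ ≈ ε ∙ (((v ∙ h₀) ∙ ((b ∙ v ⁻¹) ∙ b)) ∙ b)
          conjugate≈ = begin
            (v ∙ (h₀ ∙ b)) ∙ v ⁻¹              ≈⟨ ∙-congʳ (assoc v h₀ b) ⟨
            ((v ∙ h₀) ∙ b) ∙ v ⁻¹              ≈⟨ assoc _ b _ ⟩
            (v ∙ h₀) ∙ (b ∙ v ⁻¹)              ≈⟨ ∙-congˡ (cancelʳ b∙b≈ε (b ∙ v ⁻¹)) ⟨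
            (v ∙ h₀) ∙ (((b ∙ v ⁻¹) ∙ b) ∙ b)  ≈⟨ assoc _ _ b ⟨
            ((v ∙ h₀) ∙ ((b ∙ v ⁻¹) ∙ b)) ∙ b  ≈⟨ identityˡ _ ⟨
            ε ∙ (((v ∙ h₀) ∙ ((b ∙ v ⁻¹) ∙ b)) ∙ b) ∎

        h₀≈vh₀v : ∀ {v} → H v → ¬ ¬ (h₀ ≈ (v ∙ h₀) ∙ v)
        h₀≈vh₀v {v} Hv = do
          bv⁻¹b≈v⁻¹⁻¹ ← inverts (⁻¹-closed Hv)
          pure (trans (h₀≈vh₀∙bv⁻¹b Hv) (∙-congˡ (trans bv⁻¹b≈v⁻¹⁻¹ (⁻¹-involutive v))))

      perfect⇒RightMul-perfect : IsPerfectCode X H → IsPerfectCode X (RightMul H b)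
      perfect⇒RightMul-perfect code = perfect-code-transfer b∙b≈ε X-resp X-conj H-resp RightMul-resp
        b∙⇒RightMul ∙b∈RightMul RightMul⇒∙b code RightMul-independent
        where
        RightMul-independent : Independent X (RightMul H b)
        RightMul-independent Hbg Hbh adj = ¬¬-excluded-middle λ where
          (yes Hb) → IsPerfectCode.independent code (∈⇒RightMul⊆ Hb Hbg) (∈⇒RightMul⊆ Hb Hbh) adj
          (no ¬Hb) → Equivalence.from (RightMul-independent⇔twisted X-resp)
            (twisted-independent-transfer subgroup X-resp id refl conj-closed conj-ε
              (perfect⇒inverts-conj ¬Hb code)
              (Equivalence.to (independent⇔twisted-id {X = X}) (IsPerfectCode.independent code)))
            Hbg Hbh adj

      RightMul-perfect⇒perfect : IsPerfectCode X (RightMul H b) → IsPerfectCode X H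
      RightMul-perfect⇒perfect code = perfect-code-transfer b∙b≈ε X-resp X-conj RightMul-resp H-resp
        RightMul-b∙⇒ RightMul⇒∙b ∙b∈RightMul code independent
        where
        independent : Independent X H
        independent Hg Hh adj = ¬¬-excluded-middle λ where
          (yes Hb) → IsPerfectCode.independent code (∈⇒⊆RightMul Hb Hg) (∈⇒⊆RightMul Hb Hh) adj
          (no ¬Hb) → Equivalence.from (independent⇔twisted-id {X = X})
            (twisted-independent-transfer subgroup X-resp conj-closed conj-ε id refl
              (perfect-RightMul⇒self-inverse ¬Hb code)
              (Equivalence.to (RightMul-independent⇔twisted X-resp) (IsPerfectCode.independent code)))
            Hg Hh adj

open Group using (Carrier)
open GroupDefs

lemma3p3 : {c ℓ p q : Level} (G : Group c ℓ) → Finite G →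
    (H : Pred (Carrier G) p) → IsSubgroup G H →
    (X : Pred (Carrier G) q) → IsNormalSubset G X →
    (b : Carrier G) → IsInvolution G b → Conj G b H ≐ H →
    (IsPerfectCode G X H ⇔ IsPerfectCode G X (RightMul G H b))
lemma3p3 G _ H subgroup X normal b (b∙b≈ε , _) normalises =
  mk⇔ (perfect⇒RightMul-perfect normal) (RightMul-perfect⇒perfect normal)
  where open PerfectCodes.Coset G subgroup b∙b≈ε normalises
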